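{- Let $n>1$ be an almost-prime number. Then $n$ is either a prime or a Carmichael number.
   Context: For a positive integer $n$ with positive divisors $1=d_1<d_2<\dots<d_k=n$, define the polynomial $T_n(x)=x^{d_1}+x^{d_2}+\dots+x^{d_k}-kx$. A positive integer $n$ is called weakly almost-prime if $n\mid T_n(x)$ for all integers $x$; it is called almost-prime if it is weakly almost-prime and square-free. A Carmichael number is a composite positive integer $n$ such that $a^n\equiv a \pmod n$ for every integer $a$. -}

module Defs where

open import Data.Nat as ℕ using (ℕ; suc)
open import Data.Nat.Divisibility using (_∣?_)
import Data.Nat.Divisibility as ℕD
open import Data.Nat.Primality using (Prime; Composite)
open import Data.Integer as ℤ using (ℤ; +_)
open import Data.Integer.Divisibility using (_∣_)
open import Data.List using (List; filter; applyUpTo; length; map; foldr)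
open import Data.Product using (_×_)
open import Relation.Binary.PropositionalEquality using (_≡_)

divisors : ℕ → List ℕ
divisors n = filter (_∣? n) (applyUpTo suc n)

T : ℕ → ℤ → ℤ
T n x = foldr ℤ._+_ (+ 0) (map (λ d → x ℤ.^ d) (divisors n))
        ℤ.- (+ length (divisors n)) ℤ.* x

WeaklyAlmostPrime : ℕ → Set
WeaklyAlmostPrime n = ∀ (x : ℤ) → (+ n) ∣ T n x

SquareFree : ℕ → Set
SquareFree n = ∀ (d : ℕ) → (d ℕ.* d) ℕD.∣ n → d ≡ 1

AlmostPrime : ℕ → Set
AlmostPrime n = WeaklyAlmostPrime n × SquareFree n

Carmichael : ℕ → Set
Carmichael n = Composite n × (∀ (a : ℤ) → (+ n) ∣ (a ℤ.^ n ℤ.- a))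

-- Fix a prime p ∣ n. Since p ∣ T_n(x), ∑_{d∣n} x^d ≡ τ(n)·x (mod p) for all x. Evaluating this at
-- the powers c^i of an element c of order w < p and summing against c^(i t), the geometric sums
-- ∑_{i<w} c^(i s) ≡ w·[w ∣ s] turn it into a count: #{d ∣ n : w ∣ d + t} ≡ τ(n)·[w ∣ t + 1] (mod p).
-- For square-free n every τ(m), m ∣ n, is a power of 2, so an odd p never divides it.
-- Let a ≢ 0 (mod p) have order o < p and suppose o ∤ n − 1 (so o ≥ 2 and p is odd). A prime q
-- dividing both o and n is impossible: a^(o/q) has order q, and t = 0 gives p ∣ #{d ∣ n : q ∣ d} = τ(n/q).
-- So o is coprime to n, and d ↦ n/d matches the divisors ≡ n (mod o) with those ≡ 1 (mod o), whose
-- counts are ≡ 0 and ≡ τ(n): again p ∣ τ(n). Hence o ∣ n − 1, so a^n ≡ a (mod p) for every prime p ∣ n,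
-- and n ∣ a^n − a because n is square-free.

module Submission where

open import Defs

open import Data.Nat as ℕ using (ℕ; zero; suc; _≤_; _<_; _>_; z≤n; s≤s)
import Data.Nat.Properties as ℕₚ
open import Data.Nat.Divisibility as ℕ∣ using (_∣_; _∣?_; divides)
open import Data.Nat.DivMod using (_%_; _/_; m≡m%n+[m/n]*n; m%n<n; m/n*n≡m)
open import Data.Nat.Coprimality as Coprime using (Coprime; coprime-divisor)
open import Data.Nat.Primality
  using (Prime; prime?; ¬prime⇒composite; euclidsLemma; prime⇒nonZero; prime⇒nonTrivial; prime⇒irreducible)
open import Data.Nat.Primality.Factorisation using (factorise; PrimeFactorisation)
open import Data.Nat.ListAction using (product)
open import Data.Integer as ℤ using (ℤ; +_; _+_; _*_; _-_; -_; 0ℤ; 1ℤ; _^_)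
import Data.Integer.Properties as ℤₚ
import Data.Integer.DivMod as ℤ÷
import Data.Integer.Divisibility as ℤ∣ᵤ
import Data.Integer.Divisibility.Signed as ℤ∣
open import Data.Integer.Tactic.RingSolver using (solve-∀)
open import Algebra.Properties.CommutativeSemigroup ℤₚ.*-commutativeSemigroup using (x∙yz≈y∙xz)
open import Data.Fin as Fin using (Fin; toℕ; fromℕ<)
import Data.Fin.Properties as Finₚ
open import Data.List using (List; []; _∷_; filter; applyUpTo; length; map; foldr)
open import Data.List.Relation.Unary.All using (All; []; _∷_)
open import Data.Bool using (if_then_else_)
open import Data.Empty using (⊥-elim)
open import Data.Product using (∃; ∃₂; _×_; _,_; proj₁; proj₂)
open import Data.Sum using (_⊎_; inj₁; inj₂)
open import Function using (_∘_; _⇔_; mk⇔; Equivalence)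
import Function.Properties.Equivalence as ⇔
open import Relation.Nullary using (Dec; yes; no; does; ¬_; _×-dec_; ¬?)
open import Relation.Nullary.Decidable using (decidable-stable; map′)
open import Relation.Unary using (Decidable)
open import Relation.Binary.Bundles using (Setoid)
import Relation.Binary.Reasoning.Setoid as SetoidReasoning
open import Relation.Binary.PropositionalEquality
  using (_≡_; _≢_; refl; sym; trans; cong; cong₂; subst; module ≡-Reasoning)

-- Finite sums and indicators

infix 5 sumBelow

sumBelow : ℕ → (ℕ → ℤ) → ℤ
sumBelow zero    f = 0ℤ
sumBelow (suc n) f = f 0 + sumBelow n (f ∘ suc)

syntax sumBelow n (λ i → x) = ∑[ i < n ] x

private variable
  A B : Set
  m n q : ℕ
  f g : ℕ → ℤ

∑-cong : (∀ {i} → i < n → f i ≡ g i) → sumBelow n f ≡ sumBelow n g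
∑-cong {zero}  f≡g = refl
∑-cong {suc n} f≡g = cong₂ _+_ (f≡g (s≤s z≤n)) (∑-cong (f≡g ∘ s≤s))

∑-distrib-+ : ∀ n (f g : ℕ → ℤ) → ∑[ i < n ] (f i + g i) ≡ sumBelow n f + sumBelow n g
∑-distrib-+ zero    f g = refl
∑-distrib-+ (suc n) f g =
  trans (cong (_+_ (f 0 + g 0)) (∑-distrib-+ n (f ∘ suc) (g ∘ suc))) (swap (f 0) (g 0) _ _)
  where
  swap : ∀ a b c d → (a + b) + (c + d) ≡ (a + c) + (b + d)
  swap = solve-∀

*-distribˡ-∑ : ∀ n c (f : ℕ → ℤ) → c * sumBelow n f ≡ ∑[ i < n ] c * f i
*-distribˡ-∑ zero    c f = ℤₚ.*-zeroʳ c
*-distribˡ-∑ (suc n) c f =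
  trans (ℤₚ.*-distribˡ-+ c (f 0) _) (cong (_+_ (c * f 0)) (*-distribˡ-∑ n c (f ∘ suc)))

∑-const : ∀ n c → ∑[ i < n ] c ≡ + n * c
∑-const zero    c = sym (ℤₚ.*-zeroˡ c)
∑-const (suc n) c = trans (cong (_+_ c) (∑-const n c)) (sym (ℤₚ.suc-* (+ n) c))

∑-zero : (∀ {i} → i < n → f i ≡ 0ℤ) → sumBelow n f ≡ 0ℤ
∑-zero {n} f≡0 = trans (∑-cong f≡0) (trans (∑-const n 0ℤ) (ℤₚ.*-zeroʳ (+ n)))

∑-comm : ∀ m n (f : ℕ → ℕ → ℤ) → ∑[ i < m ] ∑[ j < n ] f i j ≡ ∑[ j < n ] ∑[ i < m ] f i j
∑-comm zero    n f = sym (∑-zero {n} (λ _ → refl))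
∑-comm (suc m) n f = trans (cong (_+_ (sumBelow n (f 0))) (∑-comm m n (f ∘ suc)))
                            (sym (∑-distrib-+ n (f 0) _))

∑-single : ∀ {k} → k < n → (∀ {i} → i < n → i ≢ k → f i ≡ 0ℤ) → sumBelow n f ≡ f k
∑-single {suc n} {f} {zero} _ f≡0 =
  trans (cong (_+_ (f 0)) (∑-zero (λ i<n → f≡0 (s≤s i<n) λ ()))) (ℤₚ.+-identityʳ (f 0))
∑-single {suc n} {f} {suc k} (s≤s k<n) f≡0 =
  trans (cong₂ _+_ (f≡0 (s≤s z≤n) λ ())
                   (∑-single k<n (λ i<n i≢k → f≡0 (s≤s i<n) (i≢k ∘ ℕₚ.suc-injective))))
        (ℤₚ.+-identityˡ (f (suc k)))

𝟙 : Dec A → ℤ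
𝟙 a? = if does a? then 1ℤ else 0ℤ

𝟙-yes : (a? : Dec A) → A → ∀ x → 𝟙 a? * x ≡ x
𝟙-yes (yes _) _ x = ℤₚ.*-identityˡ x
𝟙-yes (no ¬a) a x = ⊥-elim (¬a a)

𝟙-no : (a? : Dec A) → ¬ A → ∀ x → 𝟙 a? * x ≡ 0ℤ
𝟙-no (yes a) ¬a x = ⊥-elim (¬a a)
𝟙-no (no _)  _  x = ℤₚ.*-zeroˡ x

𝟙-×-* : (a? : Dec A) (b? : Dec B) → ∀ x → 𝟙 (a? ×-dec b?) * x ≡ 𝟙 a? * (𝟙 b? * x)
𝟙-×-* (yes _) b? x = sym (ℤₚ.*-identityˡ (𝟙 b? * x))
𝟙-×-* (no _)  b? x = refl

𝟙-cong : (a? : Dec A) (b? : Dec B) → A ⇔ B → 𝟙 a? ≡ 𝟙 b?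
𝟙-cong (yes _) (yes _) _   = refl
𝟙-cong (yes a) (no ¬b) a⇔b = ⊥-elim (¬b (Equivalence.to a⇔b a))
𝟙-cong (no ¬a) (yes b) a⇔b = ⊥-elim (¬a (Equivalence.from a⇔b b))
𝟙-cong (no _)  (no _)  _   = refl

𝟙-*-cong : (a? : Dec A) → ∀ {x y} → (A → x ≡ y) → 𝟙 a? * x ≡ 𝟙 a? * y
𝟙-*-cong (yes a) x≡y = cong (1ℤ *_) (x≡y a)
𝟙-*-cong (no ¬a) x≡y = refl

𝟙-split : (a? : Dec A) → ∀ x → x ≡ 𝟙 a? * x + 𝟙 (¬? a?) * x
𝟙-split (yes _) x = sym (trans (cong (_+ 0ℤ) (ℤₚ.*-identityˡ x)) (ℤₚ.+-identityʳ x))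
𝟙-split (no _)  x = sym (trans (ℤₚ.+-identityˡ (1ℤ * x)) (ℤₚ.*-identityˡ x))

∑-reindex : ∀ {P Q : ℕ → Set} (P? : Decidable P) (Q? : Decidable Q) (h : ℕ → ℕ) (f : ℕ → ℤ) →
            (∀ {e} → e < m → P e → h e < n × Q (h e)) →
            (∀ {d} → d < n → Q d → ∃ λ e → e < m × P e × h e ≡ d) →
            (∀ {e e′} → e < m → e′ < m → P e → P e′ → h e ≡ h e′ → e ≡ e′) →
            ∑[ d < n ] 𝟙 (Q? d) * f d ≡ ∑[ e < m ] 𝟙 (P? e) * f (h e)
∑-reindex {m} {n} {P} {Q} P? Q? h f into onto injective = begin
  ∑[ d < n ] 𝟙 (Q? d) * f d         ≡⟨ ∑-cong column ⟨
  ∑[ d < n ] ∑[ e < m ] fibre e d   ≡⟨ ∑-comm n m (λ d e → fibre e d) ⟩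
  ∑[ e < m ] ∑[ d < n ] fibre e d   ≡⟨ ∑-cong row ⟩
  ∑[ e < m ] 𝟙 (P? e) * f (h e)     ∎
  where
  open ≡-Reasoning
  fibre : ℕ → ℕ → ℤ
  fibre e d = 𝟙 (P? e ×-dec h e ℕ.≟ d) * f d

  column : ∀ {d} → d < n → ∑[ e < m ] fibre e d ≡ 𝟙 (Q? d) * f d
  column {d} d<n with Q? d
  ... | no ¬q = ∑-zero (λ {e} e<m → 𝟙-no (P? e ×-dec h e ℕ.≟ d)
                  (λ (pe , he≡d) → ¬q (subst Q he≡d (proj₂ (into e<m pe)))) (f d))
  ... | yes q with e₀ , e₀<m , pe₀ , he₀≡d ← onto d<n q = begin
    ∑[ e < m ] fibre e d  ≡⟨ ∑-single e₀<m (λ {e} e<m e≢e₀ → 𝟙-no (P? e ×-dec h e ℕ.≟ d)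
                               (λ (pe , he≡d) → e≢e₀ (injective e<m e₀<m pe pe₀ (trans he≡d (sym he₀≡d))))
                               (f d)) ⟩
    fibre e₀ d            ≡⟨ 𝟙-yes (P? e₀ ×-dec h e₀ ℕ.≟ d) (pe₀ , he₀≡d) (f d) ⟩
    f d                   ≡⟨ ℤₚ.*-identityˡ (f d) ⟨
    1ℤ * f d              ∎

  row : ∀ {e} → e < m → ∑[ d < n ] fibre e d ≡ 𝟙 (P? e) * f (h e)
  row {e} e<m = by (P? e)
    where
    by : Dec (P e) → ∑[ d < n ] fibre e d ≡ 𝟙 (P? e) * f (h e)
    by (no ¬p) = trans (∑-zero {n} (λ {d} _ → 𝟙-no (P? e ×-dec h e ℕ.≟ d) (¬p ∘ proj₁) (f d)))
                       (sym (𝟙-no (P? e) ¬p (f (h e))))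
    by (yes p) = begin
      ∑[ d < n ] fibre e d  ≡⟨ ∑-single (proj₁ (into e<m p))
                                 (λ {d} _ d≢he → 𝟙-no (P? e ×-dec h e ℕ.≟ d) (d≢he ∘ sym ∘ proj₂) (f d)) ⟩
      fibre e (h e)         ≡⟨ 𝟙-yes (P? e ×-dec h e ℕ.≟ h e) (p , refl) (f (h e)) ⟩
      f (h e)               ≡⟨ 𝟙-yes (P? e) p (f (h e)) ⟨
      𝟙 (P? e) * f (h e)    ∎

-- Congruences and multiplicative order

least-witness : ∀ {P : ℕ → Set} → Decidable P → ∀ {t} → P t →
                ∃ λ o → o ≤ t × P o × (∀ {s} → s < o → ¬ P s)
least-witness {P} P? {t} Pt = smallest (Finₚ.¬∀⟶∃¬-smallest (suc t) (¬_ ∘ P ∘ toℕ) (¬? ∘ P? ∘ toℕ) ¬∀¬P)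
  where
  ¬∀¬P : ¬ (∀ i → ¬ P (toℕ i))
  ¬∀¬P ∀¬P = ∀¬P (Fin.fromℕ t) (subst P (sym (Finₚ.toℕ-fromℕ t)) Pt)
  smallest : (∃ λ (i : Fin (suc t)) → ¬ ¬ P (toℕ i) × (∀ (j : Fin (toℕ i)) → ¬ P (toℕ (Fin.inject j)))) →
             ∃ λ o → o ≤ t × P o × (∀ {s} → s < o → ¬ P s)
  smallest (i , ¬¬Pi , below) = toℕ i , ℕ.s≤s⁻¹ (Finₚ.toℕ<n i) , decidable-stable (P? (toℕ i)) ¬¬Pi , ¬P-below
    where
    ¬P-below : ∀ {s} → s < toℕ i → ¬ P s
    ¬P-below s<i = below (fromℕ< s<i)
                 ∘ subst P (sym (trans (Finₚ.toℕ-inject (fromℕ< s<i)) (Finₚ.toℕ-fromℕ< s<i)))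

module Congruence (m : ℤ) where

  infix 4 _≈_
  record _≈_ (x y : ℤ) : Set where
    constructor from-∣
    field to-∣ : m ℤ∣.∣ x - y
  open _≈_ public

  private
    ∣-resp : ∀ {x y} → x ≡ y → m ℤ∣.∣ x → m ℤ∣.∣ y
    ∣-resp refl m∣x = m∣x

  ≡⇒≈ : ∀ {x y} → x ≡ y → x ≈ y
  ≡⇒≈ {x} refl = from-∣ (∣-resp (sym (ℤₚ.+-inverseʳ x)) (ℤ∣.divides 0ℤ refl))

  ≈-refl : ∀ {x} → x ≈ x
  ≈-refl = ≡⇒≈ refl

  ≈-sym : ∀ {x y} → x ≈ y → y ≈ x
  ≈-sym {x} {y} (from-∣ m∣x-y) = from-∣ (∣-resp (e x y) (ℤ∣.∣m⇒∣-m m∣x-y))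
    where
    e : ∀ x y → - (x - y) ≡ y - x
    e = solve-∀

  ≈-trans : ∀ {x y z} → x ≈ y → y ≈ z → x ≈ z
  ≈-trans {x} {y} {z} (from-∣ m∣x-y) (from-∣ m∣y-z) = from-∣ (∣-resp (e x y z) (ℤ∣.∣m∣n⇒∣m+n m∣x-y m∣y-z))
    where
    e : ∀ x y z → (x - y) + (y - z) ≡ x - z
    e = solve-∀

  ≈-setoid : Setoid _ _
  ≈-setoid = record { Carrier = ℤ ; _≈_ = _≈_
                    ; isEquivalence = record { refl = ≈-refl ; sym = ≈-sym ; trans = ≈-trans } }

  module ≈-Reasoning = SetoidReasoning ≈-setoid

  ∣⇒≈0 : ∀ {x} → m ℤ∣.∣ x → x ≈ 0ℤ
  ∣⇒≈0 {x} m∣x = from-∣ (∣-resp (sym (ℤₚ.+-identityʳ x)) m∣x)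

  ≈0⇒∣ : ∀ {x} → x ≈ 0ℤ → m ℤ∣.∣ x
  ≈0⇒∣ {x} (from-∣ m∣x-0) = ∣-resp (ℤₚ.+-identityʳ x) m∣x-0

  +-cong : ∀ {x y u v} → x ≈ y → u ≈ v → x + u ≈ y + v
  +-cong {x} {y} {u} {v} (from-∣ m∣x-y) (from-∣ m∣u-v) =
    from-∣ (∣-resp (e x y u v) (ℤ∣.∣m∣n⇒∣m+n m∣x-y m∣u-v))
    where
    e : ∀ x y u v → (x - y) + (u - v) ≡ (x + u) - (y + v)
    e = solve-∀

  *-cong : ∀ {x y u v} → x ≈ y → u ≈ v → x * u ≈ y * v
  *-cong {x} {y} {u} {v} (from-∣ m∣x-y) (from-∣ m∣u-v) =
    from-∣ (∣-resp (e x y u v) (ℤ∣.∣m∣n⇒∣m+n (ℤ∣.∣n⇒∣m*n x m∣u-v) (ℤ∣.∣m⇒∣m*n v m∣x-y)))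
    where
    e : ∀ x y u v → x * (u - v) + (x - y) * v ≡ x * u - y * v
    e = solve-∀

  ^-cong : ∀ {x y} k → x ≈ y → x ^ k ≈ y ^ k
  ^-cong zero    x≈y = ≈-refl
  ^-cong (suc k) x≈y = *-cong x≈y (^-cong k x≈y)

  ∑-cong-≈ : ∀ {n f g} → (∀ {i} → i < n → f i ≈ g i) → sumBelow n f ≈ sumBelow n g
  ∑-cong-≈ {zero}  f≈g = ≈-refl
  ∑-cong-≈ {suc n} f≈g = +-cong (f≈g (s≤s z≤n)) (∑-cong-≈ (f≈g ∘ s≤s))

  record HasOrder (a : ℤ) (o : ℕ) : Set where
    field
      nonZero : ℕ.NonZero o
      ^≈1⇔∣  : ∀ s → a ^ s ≈ 1ℤ ⇔ o ∣ s

  ^-*≈1 : ∀ {a o} → a ^ o ≈ 1ℤ → ∀ k → a ^ (k ℕ.* o) ≈ 1ℤ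
  ^-*≈1 {a} {o} a^o≈1 k = begin
    a ^ (k ℕ.* o)  ≡⟨ cong (a ^_) (ℕₚ.*-comm k o) ⟩
    a ^ (o ℕ.* k)  ≡⟨ ℤₚ.^-*-assoc a o k ⟨
    (a ^ o) ^ k    ≈⟨ ^-cong k a^o≈1 ⟩
    1ℤ ^ k         ≡⟨ ℤₚ.^-zeroˡ k ⟩
    1ℤ             ∎
    where
    open ≈-Reasoning

  leastPeriod⇒HasOrder : ∀ {a o} → a ^ suc o ≈ 1ℤ → (∀ {s} → s < o → ¬ a ^ suc s ≈ 1ℤ) →
                         HasOrder a (suc o)
  leastPeriod⇒HasOrder {a} {o} a^o≈1 below = record { nonZero = _ ; ^≈1⇔∣ = λ s → mk⇔ (to s) from }
    where
    from : ∀ {s} → suc o ∣ s → a ^ s ≈ 1ℤ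
    from (divides k refl) = ^-*≈1 a^o≈1 k
    ^%≈1 : ∀ s → a ^ s ≈ 1ℤ → a ^ (s % suc o) ≈ 1ℤ
    ^%≈1 s a^s≈1 = begin
      a ^ r                          ≡⟨ ℤₚ.*-identityʳ (a ^ r) ⟨
      a ^ r * 1ℤ                     ≈⟨ *-cong (≈-refl {a ^ r}) (^-*≈1 {a} {suc o} a^o≈1 k) ⟨
      a ^ r * a ^ (k ℕ.* suc o)      ≡⟨ ℤₚ.^-distribˡ-+-* a r (k ℕ.* suc o) ⟨
      a ^ (r ℕ.+ k ℕ.* suc o)        ≡⟨ cong (a ^_) (m≡m%n+[m/n]*n s (suc o)) ⟨
      a ^ s                          ≈⟨ a^s≈1 ⟩
      1ℤ                             ∎
      where
      open ≈-Reasoning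
      r k : ℕ
      r = s % suc o
      k = s / suc o
    to : ∀ s → a ^ s ≈ 1ℤ → suc o ∣ s
    to s a^s≈1 = ℕ∣.m%n≡0⇒n∣m s (suc o) (≡0 (m%n<n s (suc o)) (^%≈1 s a^s≈1))
      where
      ≡0 : ∀ {r} → r < suc o → a ^ r ≈ 1ℤ → r ≡ 0
      ≡0 {zero}  _   _     = refl
      ≡0 {suc r} r<o a^r≈1 = ⊥-elim (below (ℕ.s≤s⁻¹ r<o) a^r≈1)

  HasOrder-^ : ∀ {a} k {q} → HasOrder a (k ℕ.* q) → HasOrder (a ^ k) q
  HasOrder-^ {a} k {q} ord = record
    { nonZero = ℕₚ.m*n≢0⇒n≢0 k
    ; ^≈1⇔∣  = λ s → mk⇔ (to s) (from s)
    }
    where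
    open HasOrder ord
    instance
      kq≢0 : ℕ.NonZero (k ℕ.* q)
      kq≢0 = nonZero
      k≢0 : ℕ.NonZero k
      k≢0 = ℕₚ.m*n≢0⇒m≢0 k
    to : ∀ s → (a ^ k) ^ s ≈ 1ℤ → q ∣ s
    to s a^ks≈1 = ℕ∣.*-cancelˡ-∣ k (Equivalence.to (^≈1⇔∣ (k ℕ.* s))
                                      (≈-trans (≡⇒≈ (sym (ℤₚ.^-*-assoc a k s))) a^ks≈1))
    from : ∀ s → q ∣ s → (a ^ k) ^ s ≈ 1ℤ
    from s q∣s = ≈-trans (≡⇒≈ (ℤₚ.^-*-assoc a k s))
                         (Equivalence.from (^≈1⇔∣ (k ℕ.* s)) (ℕ∣.*-monoʳ-∣ k q∣s))

-- Divisor sums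

infix 5 divisorSum

-- d ranges over 0, …, n; the index 0 only counts when n = 0, where 0 ∣ 0.
divisorSum : ℕ → (ℕ → ℤ) → ℤ
divisorSum n g = ∑[ d < suc n ] 𝟙 (d ∣? n) * g d

syntax divisorSum n (λ d → x) = ∑[ d ∣ n ] x

τ : ℕ → ℤ
τ n = ∑[ d ∣ n ] 1ℤ

foldr-+-applyUpTo : ∀ (g : ℕ → ℤ) h k → foldr _+_ 0ℤ (map g (applyUpTo h k)) ≡ ∑[ i < k ] g (h i)
foldr-+-applyUpTo g h zero    = refl
foldr-+-applyUpTo g h (suc k) = cong (_+_ (g (h 0))) (foldr-+-applyUpTo g (h ∘ suc) k)

foldr-+-filter : ∀ {P : ℕ → Set} (P? : Decidable P) (g : ℕ → ℤ) xs →
                 foldr _+_ 0ℤ (map g (filter P? xs)) ≡ foldr _+_ 0ℤ (map (λ x → 𝟙 (P? x) * g x) xs)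
foldr-+-filter P? g []       = refl
foldr-+-filter P? g (x ∷ xs) with P? x
... | yes _ = cong₂ _+_ (sym (ℤₚ.*-identityˡ (g x))) (foldr-+-filter P? g xs)
... | no  _ = trans (foldr-+-filter P? g xs) (sym (ℤₚ.+-identityˡ _))

+length≡foldr-+ : ∀ (xs : List ℕ) → + length xs ≡ foldr _+_ 0ℤ (map (λ _ → 1ℤ) xs)
+length≡foldr-+ []       = refl
+length≡foldr-+ (x ∷ xs) = cong (_+_ 1ℤ) (+length≡foldr-+ xs)

foldr-+-divisors : ∀ n .{{_ : ℕ.NonZero n}} (g : ℕ → ℤ) → foldr _+_ 0ℤ (map g (divisors n)) ≡ ∑[ d ∣ n ] g d
foldr-+-divisors n g = begin
  foldr _+_ 0ℤ (map g (divisors n))                          ≡⟨ foldr-+-filter (_∣? n) g (applyUpTo suc n) ⟩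
  foldr _+_ 0ℤ (map (λ d → 𝟙 (d ∣? n) * g d) (applyUpTo suc n))
                                                             ≡⟨ foldr-+-applyUpTo (λ d → 𝟙 (d ∣? n) * g d) suc n ⟩
  positive                                                   ≡⟨ ℤₚ.+-identityˡ positive ⟨
  0ℤ + positive                                              ≡⟨ cong (_+ positive) (𝟙-no (0 ∣? n) 0∤n (g 0)) ⟨
  𝟙 (0 ∣? n) * g 0 + positive                                ∎
  where
  open ≡-Reasoning
  positive : ℤ
  positive = ∑[ i < n ] 𝟙 (suc i ∣? n) * g (suc i)
  0∤n : ¬ 0 ∣ n
  0∤n 0∣n = ℕ.≢-nonZero⁻¹ n (ℕ∣.0∣⇒≡0 0∣n)

T≡∑x^d-τx : ∀ n .{{_ : ℕ.NonZero n}} x → T n x ≡ (∑[ d ∣ n ] x ^ d) - τ n * x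
T≡∑x^d-τx n x = cong₂ _-_ (foldr-+-divisors n (x ^_))
  (cong (_* x) (trans (+length≡foldr-+ (divisors n)) (foldr-+-divisors n (λ _ → 1ℤ))))

∑∣-cong : ∀ {n} {g g′ : ℕ → ℤ} → (∀ {d} → d ∣ n → g d ≡ g′ d) → ∑[ d ∣ n ] g d ≡ ∑[ d ∣ n ] g′ d
∑∣-cong {n} g≡g′ = ∑-cong {suc n} (λ {d} _ → 𝟙-*-cong (d ∣? n) g≡g′)

∑∣-split : ∀ {P : ℕ → Set} (P? : Decidable P) n (g : ℕ → ℤ) →
           ∑[ d ∣ n ] g d ≡ (∑[ d ∣ n ] 𝟙 (P? d) * g d) + (∑[ d ∣ n ] 𝟙 (¬? (P? d)) * g d)
∑∣-split P? n g = begin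
  ∑[ d ∣ n ] g d                         ≡⟨ ∑-cong {suc n} (λ {d} _ → split d) ⟩
  ∑[ d < suc n ] (with-P d + without-P d) ≡⟨ ∑-distrib-+ (suc n) with-P without-P ⟩
  sumBelow (suc n) with-P + sumBelow (suc n) without-P ∎
  where
  open ≡-Reasoning
  with-P without-P : ℕ → ℤ
  with-P    d = 𝟙 (d ∣? n) * (𝟙 (P? d) * g d)
  without-P d = 𝟙 (d ∣? n) * (𝟙 (¬? (P? d)) * g d)
  split : ∀ d → 𝟙 (d ∣? n) * g d ≡ with-P d + without-P d
  split d = trans (cong (𝟙 (d ∣? n) *_) (𝟙-split (P? d) (g d))) (ℤₚ.*-distribˡ-+ (𝟙 (d ∣? n)) _ _)

∑∣-restrict : ∀ {P : ℕ → Set} (P? : Decidable P) n (g : ℕ → ℤ) →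
              ∑[ d ∣ n ] 𝟙 (P? d) * g d ≡ ∑[ d < suc n ] 𝟙 (d ∣? n ×-dec P? d) * g d
∑∣-restrict P? n g = ∑-cong {suc n} (λ {d} _ → sym (𝟙-×-* (d ∣? n) (P? d) (g d)))

prime∤⇒coprime : Prime q → ¬ q ∣ m → Coprime q m
prime∤⇒coprime q-prime q∤m (i∣q , i∣m) with prime⇒irreducible q-prime i∣q
... | inj₁ i≡1 = i≡1
... | inj₂ refl = ⊥-elim (q∤m i∣m)

∑∣-multiples : ∀ q m .{{_ : ℕ.NonZero q}} (g : ℕ → ℤ) →
               ∑[ d ∣ q ℕ.* m ] 𝟙 (q ∣? d) * g d ≡ ∑[ e ∣ m ] g (q ℕ.* e)
∑∣-multiples q m g =
  trans (∑∣-restrict (q ∣?_) (q ℕ.* m) g)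
        (∑-reindex (_∣? m) (λ d → d ∣? q ℕ.* m ×-dec q ∣? d) (q ℕ.*_) g into onto injective)
  where
  into : ∀ {e} → e < suc m → e ∣ m → q ℕ.* e < suc (q ℕ.* m) × (q ℕ.* e ∣ q ℕ.* m × q ∣ q ℕ.* e)
  into (s≤s e≤m) e∣m = s≤s (ℕₚ.*-monoʳ-≤ q e≤m) , ℕ∣.*-monoʳ-∣ q e∣m , ℕ∣.m∣m*n _
  onto : ∀ {d} → d < suc (q ℕ.* m) → d ∣ q ℕ.* m × q ∣ d → ∃ λ e → e < suc m × e ∣ m × q ℕ.* e ≡ d
  onto (s≤s d≤qm) (d∣qm , divides e refl) =
    e , s≤s (ℕₚ.*-cancelˡ-≤ q (subst (_≤ q ℕ.* m) (ℕₚ.*-comm e q) d≤qm))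
      , ℕ∣.*-cancelˡ-∣ q (subst (_∣ q ℕ.* m) (ℕₚ.*-comm e q) d∣qm) , ℕₚ.*-comm q e
  injective : ∀ {e e′} → _ → _ → _ → _ → q ℕ.* e ≡ q ℕ.* e′ → e ≡ e′
  injective _ _ _ _ = ℕₚ.*-cancelˡ-≡ _ _ q

∑∣-non-multiples : ∀ {q m} → Prime q → ¬ q ∣ m → (g : ℕ → ℤ) →
                   ∑[ d ∣ q ℕ.* m ] 𝟙 (¬? (q ∣? d)) * g d ≡ ∑[ d ∣ m ] g d
∑∣-non-multiples {q} {m} q-prime q∤m g =
  trans (∑∣-restrict (¬? ∘ (q ∣?_)) (q ℕ.* m) g)
        (∑-reindex (_∣? m) (λ d → d ∣? q ℕ.* m ×-dec ¬? (q ∣? d)) (λ d → d) g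
                   into onto (λ _ _ _ _ e≡e′ → e≡e′))
  where
  instance
    q≢0 : ℕ.NonZero q
    q≢0 = prime⇒nonZero q-prime
    m≢0 : ℕ.NonZero m
    m≢0 = ℕ.≢-nonZero λ { refl → q∤m (q ℕ∣.∣0) }
  into : ∀ {e} → e < suc m → e ∣ m → e < suc (q ℕ.* m) × (e ∣ q ℕ.* m × ¬ q ∣ e)
  into (s≤s e≤m) e∣m = s≤s (ℕₚ.≤-trans e≤m (ℕₚ.m≤n*m m q)) , ℕ∣.∣n⇒∣m*n q e∣m , λ q∣e → q∤m (ℕ∣.∣-trans q∣e e∣m)
  onto : ∀ {d} → d < suc (q ℕ.* m) → d ∣ q ℕ.* m × ¬ q ∣ d → ∃ λ e → e < suc m × e ∣ m × e ≡ d
  onto {d} _ (d∣qm , q∤d) = d , s≤s (ℕ∣.∣⇒≤ d∣m) , d∣m , refl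
    where
    d∣m : d ∣ m
    d∣m = coprime-divisor (Coprime.sym (prime∤⇒coprime q-prime q∤d)) d∣qm

τ-prime-* : ∀ {q m} → Prime q → ¬ q ∣ m → τ (q ℕ.* m) ≡ τ m + τ m
τ-prime-* {q} {m} q-prime q∤m = begin
  τ (q ℕ.* m)
    ≡⟨ ∑∣-split (q ∣?_) (q ℕ.* m) (λ _ → 1ℤ) ⟩
  (∑[ d ∣ q ℕ.* m ] 𝟙 (q ∣? d) * 1ℤ) + (∑[ d ∣ q ℕ.* m ] 𝟙 (¬? (q ∣? d)) * 1ℤ)
    ≡⟨ cong₂ _+_ (∑∣-multiples q m (λ _ → 1ℤ)) (∑∣-non-multiples q-prime q∤m (λ _ → 1ℤ)) ⟩
  τ m + τ m
    ∎
  where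
  open ≡-Reasoning
  instance
    q≢0 : ℕ.NonZero q
    q≢0 = prime⇒nonZero q-prime

∑∣-involution : ∀ n .{{_ : ℕ.NonZero n}} (c : ℕ → ℕ) → (∀ {d} → d ∣ n → d ℕ.* c d ≡ n) →
                (g : ℕ → ℤ) → ∑[ d ∣ n ] g d ≡ ∑[ d ∣ n ] g (c d)
∑∣-involution n c d*c≡n g = ∑-reindex (_∣? n) (_∣? n) c g into onto injective
  where
  c-∣ : ∀ {d} → d ∣ n → c d ∣ n
  c-∣ {d} d∣n = divides d (sym (d*c≡n d∣n))
  c≢0 : ∀ {d} → d ∣ n → ℕ.NonZero (c d)
  c≢0 {d} d∣n = ℕ.≢-nonZero λ c≡0 →
    ℕ.≢-nonZero⁻¹ n (trans (sym (d*c≡n d∣n)) (trans (cong (d ℕ.*_) c≡0) (ℕₚ.*-zeroʳ d)))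
  c-involutive : ∀ {d} → d ∣ n → c (c d) ≡ d
  c-involutive {d} d∣n = ℕₚ.*-cancelˡ-≡ (c (c d)) d (c d) {{c≢0 d∣n}}
    (trans (d*c≡n (c-∣ d∣n)) (trans (sym (d*c≡n d∣n)) (ℕₚ.*-comm d (c d))))
  into : ∀ {e} → e < suc n → e ∣ n → c e < suc n × c e ∣ n
  into _ e∣n = s≤s (ℕ∣.∣⇒≤ (c-∣ e∣n)) , c-∣ e∣n
  onto : ∀ {d} → d < suc n → d ∣ n → ∃ λ e → e < suc n × e ∣ n × c e ≡ d
  onto _ d∣n = c _ , s≤s (ℕ∣.∣⇒≤ (c-∣ d∣n)) , c-∣ d∣n , c-involutive d∣n
  injective : ∀ {e e′} → e < suc n → e′ < suc n → e ∣ n → e′ ∣ n → c e ≡ c e′ → e ≡ e′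
  injective {e} {e′} _ _ e∣n e′∣n ce≡ce′ = ℕₚ.*-cancelʳ-≡ e e′ (c e) {{c≢0 e∣n}}
    (trans (d*c≡n e∣n) (trans (sym (d*c≡n e′∣n)) (cong (e′ ℕ.*_) (sym ce≡ce′))))

-- Primes, residues and square-free numbers

∃-prime-factor : ∀ {i} .{{_ : ℕ.NonZero i}} → i ≢ 1 → ∃ λ q → Prime q × q ∣ i
∃-prime-factor {i} i≢1 = first-factor (factorise i)
  where
  first-factor : PrimeFactorisation i → ∃ λ q → Prime q × q ∣ i
  first-factor record { factors = [] ; isFactorisation = i≡1 } = ⊥-elim (i≢1 i≡1)
  first-factor record { factors = q ∷ qs ; isFactorisation = i≡q*Πqs ; factorsPrime = q-prime ∷ _ } =
    q , q-prime , divides (product qs) (trans i≡q*Πqs (ℕₚ.*-comm q (product qs)))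

-- With natural numbers only, x ≡ k (mod o + 1) is written o + 1 ∣ x + o k.
∣+*⇔∣- : ∀ o x k → suc o ∣ x ℕ.+ o ℕ.* k ⇔ + suc o ℤ∣.∣ + x - + k
∣+*⇔∣- o x k = mk⇔
  (λ o∣ → ℤ∣.∣m+n∣n⇒∣m (subst (+ suc o ℤ∣.∣_) split (ℤ∣.∣ᵤ⇒∣ o∣)) (ℤ∣.∣m⇒∣m*n (+ k) ℤ∣.∣-refl))
  (λ o∣x-k → ℤ∣.∣⇒∣ᵤ (subst (+ suc o ℤ∣.∣_) (sym split) (ℤ∣.∣m∣n⇒∣m+n o∣x-k (ℤ∣.∣m⇒∣m*n (+ k) ℤ∣.∣-refl))))
  where
  split : + (x ℕ.+ o ℕ.* k) ≡ (+ x - + k) + + suc o * + k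
  split = trans (cong (_+_ (+ x)) (ℤₚ.pos-* o k)) (e (+ x) (+ o) (+ k))
    where
    e : ∀ x o k → x + o * k ≡ (x - k) + (1ℤ + o) * k
    e = solve-∀

coprime-divisorℤ : ∀ {o e y} → Coprime o e → + o ℤ∣.∣ + e * y → + o ℤ∣.∣ y
coprime-divisorℤ {o} {e} {y} o⊥e o∣ey =
  ℤ∣.∣ᵤ⇒∣ (coprime-divisor o⊥e (subst (o ∣_) (ℤₚ.abs-* (+ e) y) (ℤ∣.∣⇒∣ᵤ o∣ey)))

cofactor-∣⇔ : ∀ {o d e} → Coprime o e → + o ℤ∣.∣ + e - + (d ℕ.* e) ⇔ + o ℤ∣.∣ + d - 1ℤ
cofactor-∣⇔ {o} {d} {e} o⊥e = mk⇔
  (λ o∣ → coprime-divisorℤ o⊥e (subst (+ o ℤ∣.∣_) (ℤₚ.neg-involutive _)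
                                  (ℤ∣.∣m⇒∣-m (subst (+ o ℤ∣.∣_) factor o∣))))
  (λ o∣d-1 → subst (+ o ℤ∣.∣_) (sym factor) (ℤ∣.∣m⇒∣-m (ℤ∣.∣n⇒∣m*n (+ e) o∣d-1)))
  where
  factor : + e - + (d ℕ.* e) ≡ - (+ e * (+ d - 1ℤ))
  factor = trans (cong (λ de → + e - de) (ℤₚ.pos-* d e)) (ring (+ e) (+ d))
    where
    ring : ∀ e d → e - d * e ≡ - (e * (d - 1ℤ))
    ring = solve-∀

neg[1-n]≡n∸1 : ∀ n .{{_ : ℕ.NonZero n}} → - (1ℤ - + n) ≡ + (n ℕ.∸ 1)
neg[1-n]≡n∸1 (suc n) = ring (+ n)
  where
  ring : ∀ n → - (1ℤ - (1ℤ + n)) ≡ n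
  ring = solve-∀

cofactor : ℕ → ℕ → ℕ
cofactor n zero    = 0
cofactor n (suc d) = n / suc d

d*cofactor≡n : ∀ {d n} → d ∣ n → d ℕ.* cofactor n d ≡ n
d*cofactor≡n {zero}      0∣n = sym (ℕ∣.0∣⇒≡0 0∣n)
d*cofactor≡n {suc d} {n} d∣n = trans (ℕₚ.*-comm (suc d) (n / suc d)) (m/n*n≡m d∣n)

cofactor-∣ : ∀ {d n} → d ∣ n → cofactor n d ∣ n
cofactor-∣ {d} d∣n = divides d (sym (d*cofactor≡n d∣n))

∑∣-residue-n≡residue-1 : ∀ n .{{_ : ℕ.NonZero n}} o → (∀ {e} → e ∣ n → Coprime (suc o) e) →
  (∑[ d ∣ n ] 𝟙 (suc o ∣? d ℕ.+ o ℕ.* n)) ≡ (∑[ d ∣ n ] 𝟙 (suc o ∣? d ℕ.+ o ℕ.* 1))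
∑∣-residue-n≡residue-1 n o coprime =
  trans (∑∣-involution n (cofactor n) d*cofactor≡n (λ d → 𝟙 (suc o ∣? d ℕ.+ o ℕ.* n)))
        (∑∣-cong {n} λ {d} d∣n → 𝟙-cong (suc o ∣? _) (suc o ∣? _) (residue-swap d∣n))
  where
  residue-swap : ∀ {d} → d ∣ n → suc o ∣ cofactor n d ℕ.+ o ℕ.* n ⇔ suc o ∣ d ℕ.+ o ℕ.* 1
  residue-swap {d} d∣n =
    ⇔.trans (∣+*⇔∣- o (cofactor n d) n) (⇔.trans cofactor≡n⇔d≡1 (⇔.sym (∣+*⇔∣- o d 1)))
    where
    cofactor≡n⇔d≡1 : + suc o ℤ∣.∣ + cofactor n d - + n ⇔ + suc o ℤ∣.∣ + d - 1ℤ
    cofactor≡n⇔d≡1 = subst (λ N → + suc o ℤ∣.∣ + cofactor n d - + N ⇔ + suc o ℤ∣.∣ + d - 1ℤ)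
                           (d*cofactor≡n d∣n) (cofactor-∣⇔ {d = d} (coprime (cofactor-∣ d∣n)))

squareFree⇒nonZero : SquareFree n → ℕ.NonZero n
squareFree⇒nonZero {zero}  sf with () ← sf 2 (4 ℕ∣.∣0)
squareFree⇒nonZero {suc n} _ = _

squareFree-∣ : SquareFree n → m ∣ n → SquareFree m
squareFree-∣ sf m∣n d d*d∣m = sf d (ℕ∣.∣-trans d*d∣m m∣n)

squareFree-*⇒∤ : SquareFree (q ℕ.* m) → Prime q → ¬ q ∣ m
squareFree-*⇒∤ {q} sf q-prime q∣m =
  ℕ.nonTrivial⇒≢1 {{prime⇒nonTrivial q-prime}} (sf q (ℕ∣.*-monoʳ-∣ q q∣m))

squareFree-induction : (P : ℕ → Set) → P 1 →
  (∀ {q m} → Prime q → ¬ q ∣ m → SquareFree m → P m → P (q ℕ.* m)) →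
  SquareFree n → P n
squareFree-induction {n} P P1 step sf = subst P (sym isFactorisation)
    (go factorsPrime (subst SquareFree isFactorisation sf))
  where
  instance
    n≢0 : ℕ.NonZero n
    n≢0 = squareFree⇒nonZero sf
  open PrimeFactorisation (factorise n)
  go : ∀ {fs} → All Prime fs → SquareFree (product fs) → P (product fs)
  go []                  _  = P1
  go {q ∷ qs} (q-prime ∷ primes) sf = step q-prime (squareFree-*⇒∤ sf q-prime) sf′ (go primes sf′)
    where
    sf′ : SquareFree (product qs)
    sf′ = squareFree-∣ sf (ℕ∣.n∣m*n q)

τ-squareFree : SquareFree n → ∃ λ r → τ n ≡ + (2 ℕ.^ r)
τ-squareFree = squareFree-induction (λ n → ∃ λ r → τ n ≡ + (2 ℕ.^ r)) (0 , refl) step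
  where
  step : ∀ {q m} → Prime q → ¬ q ∣ m → SquareFree m → (∃ λ r → τ m ≡ + (2 ℕ.^ r)) →
         ∃ λ r → τ (q ℕ.* m) ≡ + (2 ℕ.^ r)
  step {q} {m} q-prime q∤m _ (r , τm≡2^r) = suc r , (begin
    τ (q ℕ.* m)               ≡⟨ τ-prime-* q-prime q∤m ⟩
    τ m + τ m                 ≡⟨ cong₂ _+_ τm≡2^r τm≡2^r ⟩
    + (2 ℕ.^ r ℕ.+ 2 ℕ.^ r)   ≡⟨ cong (λ k → + (2 ℕ.^ r ℕ.+ k)) (ℕₚ.+-identityʳ (2 ℕ.^ r)) ⟨
    + (2 ℕ.^ suc r)           ∎)
    where
    open ≡-Reasoning

squareFree-∣-fromPrimes : ∀ {n x} → SquareFree n → (∀ {q} → Prime q → q ∣ n → q ∣ x) → n ∣ x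
squareFree-∣-fromPrimes {n} {x} sf = squareFree-induction P (λ _ → ℕ∣.1∣ x) step sf
  where
  P : ℕ → Set
  P m = (∀ {q} → Prime q → q ∣ m → q ∣ x) → m ∣ x
  step : ∀ {q m} → Prime q → ¬ q ∣ m → SquareFree m → P m → P (q ℕ.* m)
  step {q} {m} q-prime q∤m _ Pm primes∣x with Pm (λ r-prime r∣m → primes∣x r-prime (ℕ∣.∣n⇒∣m*n q r∣m))
  ... | divides k refl = ℕ∣.*-monoˡ-∣ m (coprime-divisor (prime∤⇒coprime q-prime q∤m) q∣m*k)
    where
    q∣m*k : q ∣ m ℕ.* k
    q∣m*k = subst (q ∣_) (ℕₚ.*-comm k m) (primes∣x q-prime (ℕ∣.m∣m*n m))

-- Power sums over divisors

geometric-sum : ∀ b w → (b - 1ℤ) * (∑[ i < w ] b ^ i) ≡ b ^ w - 1ℤ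
geometric-sum b zero    = ℤₚ.*-zeroʳ (b - 1ℤ)
geometric-sum b (suc w) = begin
  (b - 1ℤ) * (1ℤ + (∑[ i < w ] b ^ suc i))    ≡⟨ cong (λ S → (b - 1ℤ) * (1ℤ + S)) (*-distribˡ-∑ w b (b ^_)) ⟨
  (b - 1ℤ) * (1ℤ + b * (∑[ i < w ] b ^ i))    ≡⟨ expand b (∑[ i < w ] b ^ i) ⟩
  b - 1ℤ + b * ((b - 1ℤ) * (∑[ i < w ] b ^ i)) ≡⟨ cong (λ X → b - 1ℤ + b * X) (geometric-sum b w) ⟩
  b - 1ℤ + b * (b ^ w - 1ℤ)                    ≡⟨ collapse b (b ^ w) ⟩
  b * b ^ w - 1ℤ                               ∎
  where
  open ≡-Reasoning
  expand : ∀ b S → (b - 1ℤ) * (1ℤ + b * S) ≡ b - 1ℤ + b * ((b - 1ℤ) * S)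
  expand = solve-∀
  collapse : ∀ b X → b - 1ℤ + b * (X - 1ℤ) ≡ b * X - 1ℤ
  collapse = solve-∀

^-*-^ : ∀ c i t d → c ^ (i ℕ.* t) * (c ^ i) ^ d ≡ c ^ (i ℕ.* (d ℕ.+ t))
^-*-^ c i t d = begin
  c ^ (i ℕ.* t) * (c ^ i) ^ d        ≡⟨ cong (c ^ (i ℕ.* t) *_) (ℤₚ.^-*-assoc c i d) ⟩
  c ^ (i ℕ.* t) * c ^ (i ℕ.* d)      ≡⟨ ℤₚ.^-distribˡ-+-* c (i ℕ.* t) (i ℕ.* d) ⟨
  c ^ (i ℕ.* t ℕ.+ i ℕ.* d)          ≡⟨ cong (c ^_) (ℕₚ.+-comm (i ℕ.* t) (i ℕ.* d)) ⟩
  c ^ (i ℕ.* d ℕ.+ i ℕ.* t)          ≡⟨ cong (c ^_) (ℕₚ.*-distribˡ-+ i d t) ⟨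
  c ^ (i ℕ.* (d ℕ.+ t))              ∎
  where
  open ≡-Reasoning

∑-∑∣-interchange : ∀ n w c t →
  (∑[ i < w ] c ^ (i ℕ.* t) * (∑[ d ∣ n ] (c ^ i) ^ d)) ≡ (∑[ d ∣ n ] ∑[ i < w ] c ^ (i ℕ.* (d ℕ.+ t)))
∑-∑∣-interchange n w c t = begin
  (∑[ i < w ] c ^ (i ℕ.* t) * (∑[ d ∣ n ] (c ^ i) ^ d))
    ≡⟨ ∑-cong {w} (λ {i} _ → *-distribˡ-∑ (suc n) (c ^ (i ℕ.* t)) (λ d → 𝟙 (d ∣? n) * (c ^ i) ^ d)) ⟩
  (∑[ i < w ] ∑[ d < suc n ] c ^ (i ℕ.* t) * (𝟙 (d ∣? n) * (c ^ i) ^ d))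
    ≡⟨ ∑-cong {w} (λ {i} _ → ∑-cong {suc n} (λ {d} _ → term i d)) ⟩
  (∑[ i < w ] ∑[ d < suc n ] 𝟙 (d ∣? n) * c ^ (i ℕ.* (d ℕ.+ t)))
    ≡⟨ ∑-comm w (suc n) (λ i d → 𝟙 (d ∣? n) * c ^ (i ℕ.* (d ℕ.+ t))) ⟩
  (∑[ d < suc n ] ∑[ i < w ] 𝟙 (d ∣? n) * c ^ (i ℕ.* (d ℕ.+ t)))
    ≡⟨ ∑-cong {suc n} (λ {d} _ → *-distribˡ-∑ w (𝟙 (d ∣? n)) (λ i → c ^ (i ℕ.* (d ℕ.+ t)))) ⟨
  (∑[ d ∣ n ] ∑[ i < w ] c ^ (i ℕ.* (d ℕ.+ t)))
    ∎
  where
  open ≡-Reasoning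
  term : ∀ i d → c ^ (i ℕ.* t) * (𝟙 (d ∣? n) * (c ^ i) ^ d) ≡ 𝟙 (d ∣? n) * c ^ (i ℕ.* (d ℕ.+ t))
  term i d = trans (x∙yz≈y∙xz (c ^ (i ℕ.* t)) (𝟙 (d ∣? n)) ((c ^ i) ^ d)) (cong (𝟙 (d ∣? n) *_) (^-*-^ c i t d))

-- Arithmetic modulo a prime

module ModPrime (p : ℕ) (p-prime : Prime p) where

  open Congruence (+ p) public

  instance
    p≢0 : ℕ.NonZero p
    p≢0 = prime⇒nonZero p-prime

  infix 4 _≈?_
  _≈?_ : ∀ x y → Dec (x ≈ y)
  x ≈? y = map′ from-∣ to-∣ (+ p ℤ∣.∣? x - y)

  euclidsLemmaℤ : ∀ x y → + p ℤ∣.∣ x * y → + p ℤ∣.∣ x ⊎ + p ℤ∣.∣ y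
  euclidsLemmaℤ x y p∣xy with euclidsLemma ℤ.∣ x ∣ ℤ.∣ y ∣ p-prime (subst (p ∣_) (ℤₚ.abs-* x y) (ℤ∣.∣⇒∣ᵤ p∣xy))
  ... | inj₁ p∣x = inj₁ (ℤ∣.∣ᵤ⇒∣ p∣x)
  ... | inj₂ p∣y = inj₂ (ℤ∣.∣ᵤ⇒∣ p∣y)

  ∤∧∣*⇒∣ : ∀ {x y} → ¬ + p ℤ∣.∣ x → + p ℤ∣.∣ x * y → + p ℤ∣.∣ y
  ∤∧∣*⇒∣ {x} {y} p∤x p∣xy with euclidsLemmaℤ x y p∣xy
  ... | inj₁ p∣x = ⊥-elim (p∤x p∣x)
  ... | inj₂ p∣y = p∣y

  ∤⇒∤^ : ∀ {a} → ¬ + p ℤ∣.∣ a → ∀ k → ¬ + p ℤ∣.∣ a ^ k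
  ∤⇒∤^ p∤a zero    p∣1 = ℕ.nonTrivial⇒≢1 {{prime⇒nonTrivial p-prime}} (ℕ∣.∣1⇒≡1 (ℤ∣.∣⇒∣ᵤ p∣1))
  ∤⇒∤^ {a} p∤a (suc k) p∣a*a^k with euclidsLemmaℤ a (a ^ k) p∣a*a^k
  ... | inj₁ p∣a   = p∤a p∣a
  ... | inj₂ p∣a^k = ∤⇒∤^ p∤a k p∣a^k

  *-cancelˡ-≈ : ∀ {x y z} → ¬ + p ℤ∣.∣ x → x * y ≈ x * z → y ≈ z
  *-cancelˡ-≈ {x} {y} {z} p∤x (from-∣ p∣xy-xz) = from-∣ (∤∧∣*⇒∣ p∤x (subst (+ p ℤ∣.∣_) (factor x y z) p∣xy-xz))
    where
    factor : ∀ x y z → x * y - x * z ≡ x * (y - z)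
    factor = solve-∀

  ^≈^⇒^∸≈1 : ∀ {a i j} → ¬ + p ℤ∣.∣ a → i ≤ j → a ^ i ≈ a ^ j → a ^ (j ℕ.∸ i) ≈ 1ℤ
  ^≈^⇒^∸≈1 {a} {i} {j} p∤a i≤j a^i≈a^j = *-cancelˡ-≈ (∤⇒∤^ p∤a i) (begin
    a ^ i * a ^ (j ℕ.∸ i)   ≡⟨ ℤₚ.^-distribˡ-+-* a i (j ℕ.∸ i) ⟨
    a ^ (i ℕ.+ (j ℕ.∸ i))   ≡⟨ cong (a ^_) (ℕₚ.m+[n∸m]≡n i≤j) ⟩
    a ^ j                   ≈⟨ a^i≈a^j ⟨
    a ^ i                   ≡⟨ ℤₚ.*-identityʳ (a ^ i) ⟨
    a ^ i * 1ℤ              ∎)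
    where
    open ≈-Reasoning

  residue : ℤ → ℕ
  residue x = x ℤ÷.%ℕ p

  residue≈ : ∀ x → x ≈ + residue x
  residue≈ x = from-∣ (ℤ∣.divides (x ℤ÷./ℕ p) (trans (cong (_- + residue x) (ℤ÷.a≡a%ℕn+[a/ℕn]*n x p))
                                                     (cancel (+ residue x) ((x ℤ÷./ℕ p) * + p))))
    where
    cancel : ∀ r y → r + y - r ≡ y
    cancel = solve-∀

  -- Pigeonhole on the p residues of a⁰, …, a^(p−1), none of which is 0.
  period-exists : ∀ {a} → ¬ + p ℤ∣.∣ a → ∃ λ t → 0 < t × t < p × a ^ t ≈ 1ℤ
  period-exists {a} p∤a = collision (Finₚ.pigeonhole pred[p]<p slot)
    where
    pred[p]<p : ℕ.pred p < p
    pred[p]<p = subst (ℕ.pred p <_) (ℕₚ.suc-pred p) (ℕₚ.n<1+n (ℕ.pred p))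
    r : ℕ → ℕ
    r i = residue (a ^ i)
    r≢0 : ∀ i → ℕ.NonZero (r i)
    r≢0 i = ℕ.≢-nonZero λ rᵢ≡0 → ∤⇒∤^ p∤a i (≈0⇒∣ (≈-trans (residue≈ (a ^ i)) (≡⇒≈ (cong +_ rᵢ≡0))))
    pred[r]<pred[p] : ∀ i → ℕ.pred (r i) < ℕ.pred p
    pred[r]<pred[p] i = ℕₚ.pred-mono-< {{r≢0 i}} (ℤ÷.n%ℕd<d (a ^ i) p)
    slot : Fin p → Fin (ℕ.pred p)
    slot i = fromℕ< (pred[r]<pred[p] (toℕ i))
    collision : (∃₂ λ i j → i Fin.< j × slot i ≡ slot j) → ∃ λ t → 0 < t × t < p × a ^ t ≈ 1ℤ
    collision (i , j , i<j , slotᵢ≡slotⱼ) =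
      toℕ j ℕ.∸ toℕ i , ℕₚ.m<n⇒0<n∸m i<j , ℕₚ.≤-<-trans (ℕₚ.m∸n≤m (toℕ j) (toℕ i)) (Finₚ.toℕ<n j) ,
      ^≈^⇒^∸≈1 p∤a (ℕₚ.<⇒≤ i<j) (begin
        a ^ toℕ i      ≈⟨ residue≈ (a ^ toℕ i) ⟩
        + r (toℕ i)    ≡⟨ cong +_ rᵢ≡rⱼ ⟩
        + r (toℕ j)    ≈⟨ residue≈ (a ^ toℕ j) ⟨
        a ^ toℕ j      ∎)
      where
      open ≈-Reasoning
      rᵢ≡rⱼ : r (toℕ i) ≡ r (toℕ j)
      rᵢ≡rⱼ = ℕₚ.pred-injective {{r≢0 (toℕ i)}} {{r≢0 (toℕ j)}}
        (trans (sym (Finₚ.toℕ-fromℕ< (pred[r]<pred[p] (toℕ i))))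
               (trans (cong toℕ slotᵢ≡slotⱼ) (Finₚ.toℕ-fromℕ< (pred[r]<pred[p] (toℕ j)))))

  order-exists : ∀ {a} → ¬ + p ℤ∣.∣ a → ∃ λ o → HasOrder a o × o < p
  order-exists {a} p∤a = from-period (period-exists p∤a)
    where
    P : ℕ → Set
    P s = a ^ suc s ≈ 1ℤ
    from-least : ∀ {t} → suc t < p → (∃ λ o → o ≤ t × P o × (∀ {s} → s < o → ¬ P s)) →
                 ∃ λ o → HasOrder a o × o < p
    from-least t<p (o , o≤t , a^o≈1 , below) =
      suc o , leastPeriod⇒HasOrder a^o≈1 below , ℕₚ.≤-<-trans (s≤s o≤t) t<p
    from-period : (∃ λ t → 0 < t × t < p × a ^ t ≈ 1ℤ) → ∃ λ o → HasOrder a o × o < p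
    from-period (suc t , _ , t<p , a^t≈1) = from-least t<p (least-witness {P} (λ s → a ^ suc s ≈? 1ℤ) a^t≈1)

  ∑-^-orthogonal : ∀ {c w} → HasOrder c w → ∀ s → ∑[ i < w ] c ^ (i ℕ.* s) ≈ + w * 𝟙 (w ∣? s)
  ∑-^-orthogonal {c} {w} ord s with w ∣? s
  ... | yes w∣s = begin
    ∑[ i < w ] c ^ (i ℕ.* s)  ≈⟨ ∑-cong-≈ {w} (λ {i} _ → c^is≈1 i) ⟩
    ∑[ i < w ] 1ℤ             ≡⟨ ∑-const w 1ℤ ⟩
    + w * 1ℤ                  ∎
    where
    open ≈-Reasoning
    c^is≈1 : ∀ i → c ^ (i ℕ.* s) ≈ 1ℤ
    c^is≈1 i = Equivalence.from (HasOrder.^≈1⇔∣ ord (i ℕ.* s)) (ℕ∣.∣n⇒∣m*n i w∣s)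
  ... | no w∤s = begin
    ∑[ i < w ] c ^ (i ℕ.* s)  ≡⟨ ∑-cong {w} (λ {i} _ → c^is≡b^i i) ⟩
    ∑[ i < w ] b ^ i          ≈⟨ ∣⇒≈0 p∣∑b^i ⟩
    0ℤ                        ≡⟨ ℤₚ.*-zeroʳ (+ w) ⟨
    + w * 0ℤ                  ∎
    where
    open ≈-Reasoning
    open HasOrder ord
    b : ℤ
    b = c ^ s
    c^is≡b^i : ∀ i → c ^ (i ℕ.* s) ≡ b ^ i
    c^is≡b^i i = trans (cong (c ^_) (ℕₚ.*-comm i s)) (sym (ℤₚ.^-*-assoc c s i))
    b^w≈1 : b ^ w ≈ 1ℤ
    b^w≈1 = ≈-trans (≡⇒≈ (ℤₚ.^-*-assoc c s w)) (Equivalence.from (^≈1⇔∣ (s ℕ.* w)) (ℕ∣.n∣m*n s))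
    p∤b-1 : ¬ + p ℤ∣.∣ b - 1ℤ
    p∤b-1 p∣b-1 = w∤s (Equivalence.to (^≈1⇔∣ s) (from-∣ p∣b-1))
    p∣∑b^i : + p ℤ∣.∣ (∑[ i < w ] b ^ i)
    p∣∑b^i = ∤∧∣*⇒∣ p∤b-1 (subst (+ p ℤ∣.∣_) (sym (geometric-sum b w)) (to-∣ b^w≈1))

  count-divisors : ∀ {n} .{{_ : ℕ.NonZero n}} → (∀ x → + p ℤ∣.∣ T n x) →
                   ∀ {c w} → HasOrder c w → w < p → ∀ t →
                   (∑[ d ∣ n ] 𝟙 (w ∣? d ℕ.+ t)) ≈ τ n * 𝟙 (w ∣? suc t)
  count-divisors {n} p∣T {c} {w} ord w<p t = *-cancelˡ-≈ p∤w (begin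
    + w * (∑[ d ∣ n ] 𝟙 (w ∣? d ℕ.+ t))                      ≈⟨ by-orthogonality ⟨
    (∑[ d ∣ n ] ∑[ i < w ] c ^ (i ℕ.* (d ℕ.+ t)))            ≡⟨ ∑-∑∣-interchange n w c t ⟨
    (∑[ i < w ] c ^ (i ℕ.* t) * (∑[ d ∣ n ] (c ^ i) ^ d))    ≈⟨ by-hypothesis ⟩
    + w * (τ n * 𝟙 (w ∣? suc t))                             ∎)
    where
    open ≈-Reasoning
    p∤w : ¬ + p ℤ∣.∣ + w
    p∤w p∣w = ℕₚ.<⇒≱ w<p (ℕ∣.∣⇒≤ {{HasOrder.nonZero ord}} (ℤ∣.∣⇒∣ᵤ p∣w))
    divisor-power-sum : ∀ x → (∑[ d ∣ n ] x ^ d) ≈ τ n * x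
    divisor-power-sum x = from-∣ (subst (+ p ℤ∣.∣_) (T≡∑x^d-τx n x) (p∣T x))
    by-orthogonality : (∑[ d ∣ n ] ∑[ i < w ] c ^ (i ℕ.* (d ℕ.+ t))) ≈ + w * (∑[ d ∣ n ] 𝟙 (w ∣? d ℕ.+ t))
    by-orthogonality = begin
      (∑[ d ∣ n ] ∑[ i < w ] c ^ (i ℕ.* (d ℕ.+ t)))
        ≈⟨ ∑-cong-≈ {suc n} (λ {d} _ → *-cong (≈-refl {𝟙 (d ∣? n)}) (∑-^-orthogonal ord (d ℕ.+ t))) ⟩
      (∑[ d ∣ n ] + w * 𝟙 (w ∣? d ℕ.+ t))
        ≡⟨ ∑-cong {suc n} (λ {d} _ → x∙yz≈y∙xz (𝟙 (d ∣? n)) (+ w) (𝟙 (w ∣? d ℕ.+ t))) ⟩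
      (∑[ d < suc n ] + w * (𝟙 (d ∣? n) * 𝟙 (w ∣? d ℕ.+ t)))
        ≡⟨ *-distribˡ-∑ (suc n) (+ w) (λ d → 𝟙 (d ∣? n) * 𝟙 (w ∣? d ℕ.+ t)) ⟨
      + w * (∑[ d ∣ n ] 𝟙 (w ∣? d ℕ.+ t))
        ∎
    shift : ∀ i → c ^ (i ℕ.* t) * (τ n * c ^ i) ≡ τ n * c ^ (i ℕ.* suc t)
    shift i = trans (x∙yz≈y∙xz (c ^ (i ℕ.* t)) (τ n) (c ^ i))
                    (cong (τ n *_) (trans (cong (c ^ (i ℕ.* t) *_) (sym (ℤₚ.^-identityʳ (c ^ i))))
                                          (^-*-^ c i t 1)))
    by-hypothesis : (∑[ i < w ] c ^ (i ℕ.* t) * (∑[ d ∣ n ] (c ^ i) ^ d)) ≈ + w * (τ n * 𝟙 (w ∣? suc t))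
    by-hypothesis = begin
      (∑[ i < w ] c ^ (i ℕ.* t) * (∑[ d ∣ n ] (c ^ i) ^ d))
        ≈⟨ ∑-cong-≈ {w} (λ {i} _ → *-cong (≈-refl {c ^ (i ℕ.* t)}) (divisor-power-sum (c ^ i))) ⟩
      (∑[ i < w ] c ^ (i ℕ.* t) * (τ n * c ^ i))
        ≡⟨ ∑-cong {w} (λ {i} _ → shift i) ⟩
      (∑[ i < w ] τ n * c ^ (i ℕ.* suc t))
        ≡⟨ *-distribˡ-∑ w (τ n) (λ i → c ^ (i ℕ.* suc t)) ⟨
      τ n * (∑[ i < w ] c ^ (i ℕ.* suc t))
        ≈⟨ *-cong (≈-refl {τ n}) (∑-^-orthogonal ord (suc t)) ⟩
      τ n * (+ w * 𝟙 (w ∣? suc t))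
        ≡⟨ x∙yz≈y∙xz (τ n) (+ w) (𝟙 (w ∣? suc t)) ⟩
      + w * (τ n * 𝟙 (w ∣? suc t))
        ∎

  ∣^⇒∣ : ∀ {x} r → p ∣ x ℕ.^ r → p ∣ x
  ∣^⇒∣ zero    p∣1 = ⊥-elim (ℕ.nonTrivial⇒≢1 {{prime⇒nonTrivial p-prime}} (ℕ∣.∣1⇒≡1 p∣1))
  ∣^⇒∣ {x} (suc r) p∣x*x^r with euclidsLemma x (x ℕ.^ r) p-prime p∣x*x^r
  ... | inj₁ p∣x   = p∣x
  ... | inj₂ p∣x^r = ∣^⇒∣ r p∣x^r

  τ≉0 : 2 < p → ∀ {m} → SquareFree m → ¬ τ m ≈ 0ℤ
  τ≉0 2<p sf τm≈0 with r , τm≡2^r ← τ-squareFree sf =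
    ℕₚ.<⇒≱ 2<p (ℕ∣.∣⇒≤ (∣^⇒∣ r (ℤ∣.∣⇒∣ᵤ (subst (+ p ℤ∣.∣_) τm≡2^r (≈0⇒∣ τm≈0)))))

  module _ {n} (sf : SquareFree n) (p∣T : ∀ x → + p ℤ∣.∣ T n x) where

    instance
      n≢0 : ℕ.NonZero n
      n≢0 = squareFree⇒nonZero sf

    order-∤-primeFactor : 2 < p → ∀ {a o} → HasOrder a o → o < p →
                          ∀ {q} → Prime q → q ∣ n → ¬ q ∣ o
    order-∤-primeFactor 2<p {o = o} ord o<p {q} q-prime (divides m n≡m*q) (divides k refl) =
      τ≉0 2<p (squareFree-∣ sf (divides q (trans n≡m*q (ℕₚ.*-comm m q)))) (begin
        τ m                                   ≡⟨ multiples ⟨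
        (∑[ d ∣ n ] 𝟙 (q ∣? d ℕ.+ 0))         ≈⟨ count-divisors {n} p∣T (HasOrder-^ k ord) q<p 0 ⟩
        τ n * 𝟙 (q ∣? 1)                      ≡⟨ ℤₚ.*-comm (τ n) _ ⟩
        𝟙 (q ∣? 1) * τ n                      ≡⟨ 𝟙-no (q ∣? 1) q∤1 (τ n) ⟩
        0ℤ                                    ∎)
      where
      open ≈-Reasoning
      instance
        q≢0 : ℕ.NonZero q
        q≢0 = prime⇒nonZero q-prime
      q<p : q < p
      q<p = ℕₚ.≤-<-trans (ℕ∣.∣⇒≤ {{HasOrder.nonZero ord}} (ℕ∣.n∣m*n k)) o<p
      q∤1 : ¬ q ∣ 1
      q∤1 = ℕ.nonTrivial⇒≢1 {{prime⇒nonTrivial q-prime}} ∘ ℕ∣.∣1⇒≡1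
      multiples : (∑[ d ∣ n ] 𝟙 (q ∣? d ℕ.+ 0)) ≡ τ m
      multiples = trans (∑∣-cong {n} (λ {d} _ → trans (cong (λ x → 𝟙 (q ∣? x)) (ℕₚ.+-identityʳ d))
                                                  (sym (ℤₚ.*-identityʳ (𝟙 (q ∣? d))))))
                        (subst (λ N → (∑[ d ∣ N ] 𝟙 (q ∣? d) * 1ℤ) ≡ τ m)
                               (sym (trans n≡m*q (ℕₚ.*-comm m q))) (∑∣-multiples q m (λ _ → 1ℤ)))

    order-coprime : 2 < p → ∀ {a o} → HasOrder a o → o < p → ∀ {e} → e ∣ n → Coprime o e
    order-coprime 2<p {o = o} ord o<p e∣n {i} (i∣o , i∣e) with i ℕ.≟ 1
    ... | yes i≡1 = i≡1
    ... | no  i≢1 = ⊥-elim (common-prime (∃-prime-factor {{i≢0}} i≢1))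
      where
      i≢0 : ℕ.NonZero i
      i≢0 = ℕ.≢-nonZero λ { refl → ℕ.≢-nonZero⁻¹ o {{HasOrder.nonZero ord}} (ℕ∣.0∣⇒≡0 i∣o) }
      common-prime : ¬ ∃ λ q → Prime q × q ∣ i
      common-prime (q , q-prime , q∣i) = order-∤-primeFactor 2<p ord o<p q-prime
        (ℕ∣.∣-trans q∣i (ℕ∣.∣-trans i∣e e∣n)) (ℕ∣.∣-trans q∣i i∣o)

    order∣n∸1 : ∀ {a o} → HasOrder a o → o < p → o ∣ n ℕ.∸ 1
    order∣n∸1 {o = zero}  ord _   = ⊥-elim (ℕ.≢-nonZero⁻¹ 0 {{HasOrder.nonZero ord}} refl)
    order∣n∸1 {o = suc o} ord o<p with suc o ∣? n ℕ.∸ 1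
    ... | yes o∣n∸1 = o∣n∸1
    ... | no  o∤n∸1 = ⊥-elim (τ≉0 2<p sf (begin
      τ n                                         ≈⟨ residue-1 ⟨
      (∑[ d ∣ n ] 𝟙 (suc o ∣? d ℕ.+ o ℕ.* 1))    ≡⟨ ∑∣-residue-n≡residue-1 n o (order-coprime 2<p ord o<p) ⟨
      (∑[ d ∣ n ] 𝟙 (suc o ∣? d ℕ.+ o ℕ.* n))    ≈⟨ residue-n ⟩
      0ℤ                                          ∎))
      where
      open ≈-Reasoning
      2<p : 2 < p
      2<p = ℕₚ.≤-<-trans (s≤s (ℕₚ.n≢0⇒n>0 λ { refl → o∤n∸1 (ℕ∣.1∣ _) })) o<p
      o∣1+o*1 : suc o ∣ suc (o ℕ.* 1)
      o∣1+o*1 = subst (suc o ∣_) (cong suc (sym (ℕₚ.*-identityʳ o))) ℕ∣.∣-refl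
      o∤1+o*n : ¬ suc o ∣ suc (o ℕ.* n)
      o∤1+o*n o∣ = o∤n∸1 (ℤ∣.∣⇒∣ᵤ (subst (+ suc o ℤ∣.∣_) (neg[1-n]≡n∸1 n)
                                    (ℤ∣.∣m⇒∣-m (Equivalence.to (∣+*⇔∣- o 1 n) o∣))))
      residue-1 : (∑[ d ∣ n ] 𝟙 (suc o ∣? d ℕ.+ o ℕ.* 1)) ≈ τ n
      residue-1 = ≈-trans (count-divisors {n} p∣T ord o<p (o ℕ.* 1))
        (≡⇒≈ (trans (ℤₚ.*-comm (τ n) _) (𝟙-yes (suc o ∣? suc (o ℕ.* 1)) o∣1+o*1 (τ n))))
      residue-n : (∑[ d ∣ n ] 𝟙 (suc o ∣? d ℕ.+ o ℕ.* n)) ≈ 0ℤ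
      residue-n = ≈-trans (count-divisors {n} p∣T ord o<p (o ℕ.* n))
        (≡⇒≈ (trans (ℤₚ.*-comm (τ n) _) (𝟙-no (suc o ∣? suc (o ℕ.* n)) o∤1+o*n (τ n))))

    ^n≈ : ∀ a → a ^ n ≈ a
    ^n≈ a = begin
      a ^ n               ≡⟨ cong (a ^_) (ℕₚ.m+[n∸m]≡n (ℕ.>-nonZero⁻¹ n)) ⟨
      a * a ^ (n ℕ.∸ 1)   ≈⟨ by-cases (+ p ℤ∣.∣? a) ⟩
      a                   ∎
      where
      open ≈-Reasoning
      from-order : (∃ λ o → HasOrder a o × o < p) → a * a ^ (n ℕ.∸ 1) ≈ a
      from-order (o , ord , o<p) = begin
        a * a ^ (n ℕ.∸ 1)  ≈⟨ *-cong (≈-refl {a}) a^[n∸1]≈1 ⟩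
        a * 1ℤ             ≡⟨ ℤₚ.*-identityʳ a ⟩
        a                  ∎
        where
        a^[n∸1]≈1 : a ^ (n ℕ.∸ 1) ≈ 1ℤ
        a^[n∸1]≈1 = Equivalence.from (HasOrder.^≈1⇔∣ ord (n ℕ.∸ 1)) (order∣n∸1 ord o<p)
      by-cases : Dec (+ p ℤ∣.∣ a) → a * a ^ (n ℕ.∸ 1) ≈ a
      by-cases (yes p∣a) = ≈-trans (∣⇒≈0 (ℤ∣.∣m⇒∣m*n (a ^ (n ℕ.∸ 1)) p∣a)) (≈-sym (∣⇒≈0 p∣a))
      by-cases (no  p∤a) = from-order (order-exists p∤a)

theorem1p5 : (n : ℕ) → n > 1 → AlmostPrime n → Prime n ⊎ Carmichael n
theorem1p5 n n>1 (n-wap , n-sqfree) with prime? n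
... | yes n-prime = inj₁ n-prime
... | no  ¬n-prime = inj₂ (¬prime⇒composite {{ℕ.n>1⇒nonTrivial n>1}} ¬n-prime , n∣a^n-a)
  where
  n∣a^n-a : ∀ a → (+ n) ℤ∣ᵤ.∣ (a ^ n - a)
  n∣a^n-a a = squareFree-∣-fromPrimes {n} {ℤ.∣ a ^ n - a ∣} n-sqfree q∣a^n-a
    where
    q∣a^n-a : ∀ {q} → Prime q → q ∣ n → q ∣ ℤ.∣ a ^ n - a ∣
    q∣a^n-a {q} q-prime q∣n = ℤ∣.∣⇒∣ᵤ (Congruence.to-∣
      (ModPrime.^n≈ q q-prime {n} n-sqfree (λ x → ℤ∣.∣-trans (ℤ∣.∣ᵤ⇒∣ {+ q} {+ n} q∣n) (ℤ∣.∣ᵤ⇒∣ (n-wap x))) a))
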